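{- Suppose $x,x',y,y',z,z'\in\mathbb{R}$ satisfy the eight inequalities $X+Y+Z\ge 0$ for all $X\in\{x,x'\}$, $Y\in\{y,y'\}$, $Z\in\{z,z'\}$. Then there exist nonnegative reals $\tilde x,\tilde x',\tilde y,\tilde y',\tilde z,\tilde z'$ such that each of the eight sums $X+Y+Z$ is unchanged when $x,x',y,y',z,z'$ are replaced by $\tilde x,\tilde x',\tilde y,\tilde y',\tilde z,\tilde z'$ respectively. -}

module Defs where

open import Level using (Level; _⊔_) renaming (suc to lsuc)
open import Algebra.Bundles using (CommutativeRing)
open import Relation.Binary.Structures using (IsTotalOrder)
open import Relation.Nullary using (¬_)
open import Data.Product using (∃; _×_)

-- The real numbers, axiomatised as a complete (Dedekind/sup-complete)
-- totally ordered field.  Every such structure is isomorphic to ℝ, so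
-- quantifying over all of them states the claim for ℝ.
record Reals (c ℓ : Level) : Set (lsuc (c ⊔ ℓ)) where
  field
    commutativeRing : CommutativeRing c ℓ
  open CommutativeRing commutativeRing public
  infix 4 _≤_
  field
    _≤_          : Carrier → Carrier → Set ℓ
    isTotalOrder : IsTotalOrder _≈_ _≤_
    +-monoˡ-≤    : ∀ {x y} z → x ≤ y → x + z ≤ y + z
    *-nonneg     : ∀ {x y} → 0# ≤ x → 0# ≤ y → 0# ≤ x * y
    0≉1          : ¬ (0# ≈ 1#)
    inverse      : ∀ x → ¬ (x ≈ 0#) → ∃ λ y → x * y ≈ 1#
    sup          : (P : Carrier → Set ℓ) → ∃ P → (∃ λ b → ∀ x → P x → x ≤ b) →
                   ∃ λ s → (∀ x → P x → x ≤ s) × (∀ b → (∀ x → P x → x ≤ b) → s ≤ b)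

-- Let a, b, d be the minima of {x, x′}, {y, y′}, {z, z′}.  Since a + b + d is
-- one of the eight sums, it is nonnegative.  Moving b and d from the y- and
-- z-coordinates to the x-coordinate, i.e. taking x̃ = x + b + d, ỹ = y − b and
-- z̃ = z − d (and likewise for the primed ones), leaves all eight sums
-- unchanged; ỹ, ỹ′, z̃, z̃′ ≥ 0 by minimality of b and d, and
-- x̃, x̃′ ≥ a + b + d ≥ 0 by minimality of a.
module Submission where

open import Defs
open import Level using (Level)
open import Data.Product using (Σ-syntax; _×_; _,_)
open import Data.Sum using (inj₁; inj₂)
open import Relation.Binary.Structures using (IsTotalOrder)
open import Relation.Binary.Core using (Rel)
open import Relation.Binary.Definitions using (Reflexive; Total)
open import Algebra.Bundles using (AbelianGroup)
import Relation.Binary.Reasoning.Setoid as SetoidReasoning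
import Algebra.Solver.CommutativeMonoid as CommutativeMonoidSolver

module _ {a r p : Level} {A : Set a} {_≤_ : Rel A r}
         (≤-refl : Reflexive _≤_) (≤-total : Total _≤_) where

  min-with : (P : A → Set p) → ∀ u v → P u → P v →
             Σ[ m ∈ A ] P m × m ≤ u × m ≤ v
  min-with P u v pu pv with ≤-total u v
  ... | inj₁ u≤v = u , pu , ≤-refl , u≤v
  ... | inj₂ v≤u = v , pv , v≤u , ≤-refl

module _ {c ℓ : Level} (G : AbelianGroup c ℓ) where
  open AbelianGroup G
  open SetoidReasoning setoid

  ∙-shift : ∀ p q r b d → (p ∙ b ∙ d) ∙ (q ∙ b ⁻¹) ∙ (r ∙ d ⁻¹) ≈ p ∙ q ∙ r
  ∙-shift p q r b d = begin
    (p ∙ b ∙ d) ∙ (q ∙ b ⁻¹) ∙ (r ∙ d ⁻¹)   ≈⟨ rearrange ⟩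
    (p ∙ q ∙ r) ∙ (b ∙ b ⁻¹) ∙ (d ∙ d ⁻¹)   ≈⟨ ∙-cong (∙-congˡ (inverseʳ b)) (inverseʳ d) ⟩
    (p ∙ q ∙ r) ∙ ε ∙ ε                     ≈⟨ identityʳ _ ⟩
    (p ∙ q ∙ r) ∙ ε                         ≈⟨ identityʳ _ ⟩
    p ∙ q ∙ r                               ∎
    where
    open CommutativeMonoidSolver commutativeMonoid
    rearrange : (p ∙ b ∙ d) ∙ (q ∙ b ⁻¹) ∙ (r ∙ d ⁻¹) ≈ (p ∙ q ∙ r) ∙ (b ∙ b ⁻¹) ∙ (d ∙ d ⁻¹)
    rearrange = solve 7 (λ p q r b d b⁻¹ d⁻¹ →
      ((((p ⊕ b) ⊕ d) ⊕ (q ⊕ b⁻¹)) ⊕ (r ⊕ d⁻¹)) ⊜ ((((p ⊕ q) ⊕ r) ⊕ (b ⊕ b⁻¹)) ⊕ (d ⊕ d⁻¹)))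
      refl p q r b d (b ⁻¹) (d ⁻¹)

module RealsProperties {c ℓ : Level} (R : Reals c ℓ) where
  open Reals R
  open IsTotalOrder isTotalOrder public
    using () renaming (reflexive to ≤-reflexive; trans to ≤-trans; total to ≤-total)

  ≤-refl : ∀ {u} → u ≤ u
  ≤-refl = ≤-reflexive refl

  x≤y⇒0≤y-x : ∀ {x y} → x ≤ y → 0# ≤ y - x
  x≤y⇒0≤y-x {x} x≤y = ≤-trans (≤-reflexive (sym (-‿inverseʳ x))) (+-monoˡ-≤ (- x) x≤y)

  +-+-monoˡ-≤ : ∀ {x x′} b d → x ≤ x′ → x + b + d ≤ x′ + b + d
  +-+-monoˡ-≤ b d x≤x′ = +-monoˡ-≤ d (+-monoˡ-≤ b x≤x′)

  +-shift : ∀ p q r b d → (p + b + d) + (q - b) + (r - d) ≈ p + q + r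
  +-shift = ∙-shift +-abelianGroup

mainTheorem6 : ∀ {c ℓ : Level} (R : Reals c ℓ) → let open Reals R in
    ∀ (x x′ y y′ z z′ : Carrier) →
    0# ≤ x + y + z → 0# ≤ x + y + z′ → 0# ≤ x + y′ + z → 0# ≤ x + y′ + z′ →
    0# ≤ x′ + y + z → 0# ≤ x′ + y + z′ → 0# ≤ x′ + y′ + z → 0# ≤ x′ + y′ + z′ →
    Σ[ tx ∈ Carrier ] Σ[ tx′ ∈ Carrier ] Σ[ ty ∈ Carrier ] Σ[ ty′ ∈ Carrier ] Σ[ tz ∈ Carrier ] Σ[ tz′ ∈ Carrier ]
      ((0# ≤ tx) × (0# ≤ tx′) × (0# ≤ ty) × (0# ≤ ty′) × (0# ≤ tz) × (0# ≤ tz′)) ×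
      ((tx + ty + tz ≈ x + y + z) × (tx + ty + tz′ ≈ x + y + z′) ×
       (tx + ty′ + tz ≈ x + y′ + z) × (tx + ty′ + tz′ ≈ x + y′ + z′) ×
       (tx′ + ty + tz ≈ x′ + y + z) × (tx′ + ty + tz′ ≈ x′ + y + z′) ×
       (tx′ + ty′ + tz ≈ x′ + y′ + z) × (tx′ + ty′ + tz′ ≈ x′ + y′ + z′))
mainTheorem6 R x x′ y y′ z z′ h₁ h₂ h₃ h₄ h₅ h₆ h₇ h₈ =
  let open Reals R
      open RealsProperties R
      (d , (g₁ , g₂ , g₃ , g₄) , d≤z , d≤z′) = min-with ≤-refl ≤-total
        (λ w → (0# ≤ x + y + w) × (0# ≤ x + y′ + w) × (0# ≤ x′ + y + w) × (0# ≤ x′ + y′ + w))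
        z z′ (h₁ , h₃ , h₅ , h₇) (h₂ , h₄ , h₆ , h₈)
      (b , (k₁ , k₂) , b≤y , b≤y′) = min-with ≤-refl ≤-total
        (λ w → (0# ≤ x + w + d) × (0# ≤ x′ + w + d)) y y′ (g₁ , g₃) (g₂ , g₄)
      (a , 0≤a+b+d , a≤x , a≤x′) = min-with ≤-refl ≤-total
        (λ w → 0# ≤ w + b + d) x x′ k₁ k₂
  in
  x + b + d , x′ + b + d , y - b , y′ - b , z - d , z′ - d ,
  ( ≤-trans 0≤a+b+d (+-+-monoˡ-≤ b d a≤x) , ≤-trans 0≤a+b+d (+-+-monoˡ-≤ b d a≤x′)
  , x≤y⇒0≤y-x b≤y , x≤y⇒0≤y-x b≤y′ , x≤y⇒0≤y-x d≤z , x≤y⇒0≤y-x d≤z′ ) ,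
  ( +-shift x y z b d , +-shift x y z′ b d , +-shift x y′ z b d , +-shift x y′ z′ b d
  , +-shift x′ y z b d , +-shift x′ y z′ b d , +-shift x′ y′ z b d , +-shift x′ y′ z′ b d )
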